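{- Let $t$ be a binary tree with $n$ nodes and let $\mathrm{BP}_\mathrm{b}(t)$ be its balanced-parenthesis encoding (defined in the context). For every $i \in \{1,\dots,n\}$, the $i$-th opening parenthesis (counted from the left) of $\mathrm{BP}_\mathrm{b}(t)$ belongs to the matching pair corresponding to the $i$-th node of $t$ in preorder, and the $i$-th closing parenthesis of $\mathrm{BP}_\mathrm{b}(t)$ belongs to the matching pair corresponding to the $i$-th node of $t$ in inorder.
   Context: A binary tree is a rooted tree in which every node has a left child slot and a right child slot, each possibly empty. Its BP encoding is defined recursively: $\mathrm{BP}_\mathrm{b}(t)=\epsilon$ (empty string) if $t$ is empty, and otherwise $\mathrm{BP}_\mathrm{b}(t) = \texttt{(}\cdot \mathrm{BP}_\mathrm{b}(t_l)\cdot \texttt{)}\cdot \mathrm{BP}_\mathrm{b}(t_r)$, where $t_l,t_r$ are the subtrees rooted at the left and right child of the root. The node $v$ corresponds to the matching pair of parentheses $\texttt{(}$,$\texttt{)}$ inserted when the recursion expands the subtree rooted at $v$. Preorder visits the root, then the left subtree, then the right subtree; inorder visits the left subtree, then the root, then the right subtree. -}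

module Defs where

open import Data.Nat using (ℕ; zero; suc; _+_)
open import Data.List using (List; []; _∷_; _++_; map)
open import Data.Maybe using (Maybe; just; nothing)
open import Data.Product using (_×_; _,_)

data BT : Set where
  empty : BT
  node  : BT → BT → BT

size : BT → ℕ
size empty      = zero
size (node l r) = suc (size l + size r)

-- Nodes of a tree are identified by their address (path from the root).
data Dir : Set where
  L R : Dir

Node : Set
Node = List Dir

data Paren : Set where
  op cl : Paren

-- BP_b(t) where each parenthesis is tagged with the node whose matching
-- pair it belongs to (the node whose subtree is being expanded).
BPtag : Node → BT → List (Paren × Node)
BPtag a empty      = []
BPtag a (node l r) =
  ((op , a) ∷ BPtag (a ++ (L ∷ [])) l) ++ ((cl , a) ∷ BPtag (a ++ (R ∷ [])) r)

BPb-tagged : BT → List (Paren × Node)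
BPb-tagged t = BPtag [] t

BPb : BT → List Paren
BPb t = map (λ p → Data.Product.proj₁ p) (BPb-tagged t)

preorderFrom : Node → BT → List Node
preorderFrom a empty      = []
preorderFrom a (node l r) =
  a ∷ (preorderFrom (a ++ (L ∷ [])) l ++ preorderFrom (a ++ (R ∷ [])) r)

inorderFrom : Node → BT → List Node
inorderFrom a empty      = []
inorderFrom a (node l r) =
  inorderFrom (a ++ (L ∷ [])) l ++ (a ∷ inorderFrom (a ++ (R ∷ [])) r)

preorder : BT → List Node
preorder t = preorderFrom [] t

inorder : BT → List Node
inorder t = inorderFrom [] t

-- 0-based safe indexing.
nth : {A : Set} → List A → ℕ → Maybe A
nth []       _       = nothing
nth (x ∷ xs) zero    = just x
nth (x ∷ xs) (suc i) = nth xs i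

opensOf : List (Paren × Node) → List Node
opensOf []              = []
opensOf ((op , v) ∷ xs) = v ∷ opensOf xs
opensOf ((cl , v) ∷ xs) = opensOf xs

closesOf : List (Paren × Node) → List Node
closesOf []              = []
closesOf ((op , v) ∷ xs) = closesOf xs
closesOf ((cl , v) ∷ xs) = v ∷ closesOf xs

{-# OPTIONS --safe #-}
-- The opening parenthesis of a node is emitted before everything of its left
-- subtree, which in turn precedes its right subtree: exactly preorder. Its
-- closing parenthesis sits between the two subtrees: exactly inorder. So the
-- tag sequences of opening and closing parentheses *are* the preorder and the
-- inorder node lists, and both have length n.
module Submission where

open import Defs
open import Data.Nat using (ℕ; _≤_; _∸_; _<_; zero; suc; s≤s; _+_)
open import Data.Nat.Properties using (+-suc)
open import Data.Maybe using (just)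
open import Data.Product using (_×_; ∃; _,_)
open import Data.List using (List; []; _∷_; _++_; length)
open import Data.List.Properties using (length-++)
open import Relation.Binary.PropositionalEquality
  using (_≡_; refl; cong; cong₂; sym; trans; subst)

opensOf-++ : (xs ys : List (Paren × Node)) → opensOf (xs ++ ys) ≡ opensOf xs ++ opensOf ys
opensOf-++ []              ys = refl
opensOf-++ ((op , v) ∷ xs) ys = cong (v ∷_) (opensOf-++ xs ys)
opensOf-++ ((cl , v) ∷ xs) ys = opensOf-++ xs ys

closesOf-++ : (xs ys : List (Paren × Node)) → closesOf (xs ++ ys) ≡ closesOf xs ++ closesOf ys
closesOf-++ []              ys = refl
closesOf-++ ((op , v) ∷ xs) ys = closesOf-++ xs ys
closesOf-++ ((cl , v) ∷ xs) ys = cong (v ∷_) (closesOf-++ xs ys)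

opensOf-BPtag : (a : Node) (t : BT) → opensOf (BPtag a t) ≡ preorderFrom a t
opensOf-BPtag a empty      = refl
opensOf-BPtag a (node l r) = cong (a ∷_) (trans
  (opensOf-++ (BPtag (a ++ L ∷ []) l) _)
  (cong₂ _++_ (opensOf-BPtag _ l) (opensOf-BPtag _ r)))

closesOf-BPtag : (a : Node) (t : BT) → closesOf (BPtag a t) ≡ inorderFrom a t
closesOf-BPtag a empty      = refl
closesOf-BPtag a (node l r) = trans
  (closesOf-++ (BPtag (a ++ L ∷ []) l) _)
  (cong₂ _++_ (closesOf-BPtag _ l) (cong (a ∷_) (closesOf-BPtag _ r)))

length-preorderFrom : (a : Node) (t : BT) → length (preorderFrom a t) ≡ size t
length-preorderFrom a empty      = refl
length-preorderFrom a (node l r) = cong suc (trans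
  (length-++ (preorderFrom _ l))
  (cong₂ _+_ (length-preorderFrom _ l) (length-preorderFrom _ r)))

length-inorderFrom : (a : Node) (t : BT) → length (inorderFrom a t) ≡ size t
length-inorderFrom a empty      = refl
length-inorderFrom a (node l r) = trans
  (length-++ (inorderFrom _ l))
  (trans (cong₂ _+_ (length-inorderFrom _ l) (cong suc (length-inorderFrom _ r)))
         (+-suc (size l) (size r)))

nth-defined : {A : Set} (xs : List A) (j : ℕ) → j < length xs → ∃ λ v → nth xs j ≡ just v
nth-defined (x ∷ xs) zero    _         = x , refl
nth-defined (x ∷ xs) (suc j) (s≤s j<n) = nth-defined xs j j<n

nth-≡-defined : {A : Set} {xs ys : List A} (j : ℕ) → xs ≡ ys → j < length ys →
  ∃ λ v → nth xs j ≡ just v × nth ys j ≡ just v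
nth-≡-defined {ys = ys} j refl j<n with nth-defined ys j j<n
... | v , eq = v , eq , eq

proposition4 : (t : BT) (i : ℕ) → 1 ≤ i → i ≤ size t →
    (∃ λ v → nth (opensOf (BPb-tagged t)) (i ∸ 1) ≡ just v × nth (preorder t) (i ∸ 1) ≡ just v)
    × (∃ λ v → nth (closesOf (BPb-tagged t)) (i ∸ 1) ≡ just v × nth (inorder t) (i ∸ 1) ≡ just v)
proposition4 t (suc j) _ j<n =
    nth-≡-defined j (opensOf-BPtag [] t)
      (subst (j <_) (sym (length-preorderFrom [] t)) j<n)
  , nth-≡-defined j (closesOf-BPtag [] t)
      (subst (j <_) (sym (length-inorderFrom [] t)) j<n)
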